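{- Let $m\ge2$ and let $S$ be an $m$-reduced zigzag stack on $[n]$ with $\deg(1)=1$, whose primary component $C$ has $k\ge3$ vertices. Suppose the vertices of $C$ are $1=u_1<u_2<\dots<u_{\lceil k/2\rceil}<v_{\lfloor k/2\rfloor}<\dots<v_2<v_1$ and its arcs are $e_1=(u_1,v_1)$, $e_2=(u_2,v_1)$, $e_3=(u_2,v_2)$, $\dots$, i.e. $(u_s,v_s)$ for $1\le s\le\lfloor k/2\rfloor$ and $(u_{s+1},v_s)$ for $1\le s\le \lceil k/2\rceil-1$. For $u<v$ write $\langle u,v\rangle=\{u+1,\dots,v-1\}$. Then: (1) If $k$ is even, the substructure of $S$ on $\langle u_{k/2},v_{k/2}\rangle$ is of type $T_1$, on $\langle v_{k/2},v_{k/2-1}\rangle$ of type $T_2$, on $\langle u_i,u_{i+1}\rangle$ of type $T_4'$ for $1\le i\le k/2-1$, on $\langle v_j,v_{j-1}\rangle$ of type $T_4$ for $2\le j\le k/2-1$, and on $\{v_1+1,\dots,n\}$ of type $T_4^*$. (2) If $k$ is odd, the substructure on $\langle u_{(k+1)/2},v_{(k-1)/2}\rangle$ is of type $T_1$, on $\langle u_{(k-1)/2},u_{(k+1)/2}\rangle$ of type $T_2'$, on $\langle u_i,u_{i+1}\rangle$ of type $T_4'$ for $1\le i\le (k-1)/2-1$, on $\langle v_j,v_{j-1}\rangle$ of type $T_4$ for $2\le j\le (k-1)/2$, and on $\{v_1+1,\dots,n\}$ of type $T_4^*$.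
   Context: $[n]=\{1,\dots,n\}$. A diagram is a simple graph on vertices placed in increasing order on a line; edge $\{i,j\}$, $i<j$, is an arc $(i,j)$; arcs $(i_1,j_1),(i_2,j_2)$ cross if $i_1<i_2<j_1<j_2$; a stack has no crossing arcs. $\mathrm{ld}(v)$ (resp. $\mathrm{rd}(v)$) is the number of arcs $(i,v)$, $i<v$ (resp. $(v,j)$, $j>v$); $\deg=\mathrm{ld}+\mathrm{rd}$. A zigzag stack: a stack with all degrees $\le2$ and no vertex with both $\mathrm{ld}>0$ and $\mathrm{rd}>0$. Fix $m\ge 2$. A zigzag stack on $[n]$ is $m$-reduced if $\mathrm{ld}(i)+\mathrm{rd}(i+m-1)\le2$ for $1\le i\le n-m+1$, and $j-i\ge m-1$ whenever $i<j$, $\mathrm{ld}(i)>0$, $\mathrm{rd}(j)>0$. The primary component is the connected component of vertex $1$. The substructure of $S$ on $I=\{u+1,\dots,u+\ell\}$ is the diagram on $[\ell]$ whose arcs are $(i-u,j-u)$ for the arcs $(i,j)$ of $S$ with $i,j\in I$. Boundary types: for $a,b\in\{0,1,2\}$, an $m$-reduced zigzag stack $T$ on $[\ell]$ ($\ell\ge0$) is of type $(a,b)$ if, on vertex set $\{0,\dots,\ell+1\}$ with $\lambda(0)=a,\rho(0)=0$, $\lambda(k)=\mathrm{ld}_T(k),\rho(k)=\mathrm{rd}_T(k)$ for $1\le k\le\ell$, $\lambda(\ell+1)=0,\rho(\ell+1)=b$, we have (i) $\lambda(i)+\rho(i+m-1)\le2$ for all $0\le i\le \ell+2-m$ and (ii)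 $j-i\ge m-1$ for all $0\le i<j\le\ell+1$ with $\lambda(i)>0,\rho(j)>0$. It is of type $(a,*)$ if the same holds on vertex set $\{0,\dots,\ell\}$ (no right boundary vertex; (i) for $0\le i\le \ell+1-m$, (ii) for $0\le i<j\le\ell$). Types: $T_1=(0,0)$, $T_2=(1,0)$, $T_2'=(0,1)$, $T_4=(2,0)$, $T_4'=(0,2)$, $T_4^*=(2,*)$. -}

module Defs where

open import Data.Bool using (Bool; true; false; _∧_; if_then_else_)
open import Data.Nat using (ℕ; zero; suc; _+_; _*_; _∸_; _≤_; _<_; _≤ᵇ_; _<ᵇ_; _≡ᵇ_; ⌊_/2⌋; ⌈_/2⌉)
open import Data.Maybe using (Maybe; just; nothing)
open import Data.Product using (Σ; _×_; _,_; proj₁; proj₂; ∃-syntax)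
open import Data.Sum using (_⊎_)
open import Relation.Binary.PropositionalEquality using (_≡_)
open import Relation.Nullary using (¬_)
open import Function.Bundles using (_⇔_)

-- A diagram on [n] is given by its arc indicator: A i j ≡ true iff (i , j) is an arc.
-- Simplicity (no multiple arcs, no loops) is built in: arcs are pairs i < j.
Arcs : Set
Arcs = ℕ → ℕ → Bool

IsDiagram : ℕ → Arcs → Set
IsDiagram n A = ∀ i j → A i j ≡ true → 1 ≤ i × i < j × j ≤ n

count : (ℕ → Bool) → ℕ → ℕ
count f zero = 0
count f (suc N) = count f N + (if f N then 1 else 0)

ld : Arcs → ℕ → ℕ
ld A v = count (λ i → (1 ≤ᵇ i) ∧ A i v) v

rd : ℕ → Arcs → ℕ → ℕ
rd n A v = count (λ j → (v <ᵇ j) ∧ A v j) (suc n)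

deg : ℕ → Arcs → ℕ → ℕ
deg n A v = ld A v + rd n A v

IsStack : Arcs → Set
IsStack A = ∀ i₁ j₁ i₂ j₂ → A i₁ j₁ ≡ true → A i₂ j₂ ≡ true →
            ¬ (i₁ < i₂ × i₂ < j₁ × j₁ < j₂)

IsZigzagStack : ℕ → Arcs → Set
IsZigzagStack n A =
  IsDiagram n A × IsStack A ×
  (∀ v → 1 ≤ v → v ≤ n → deg n A v ≤ 2) ×
  (∀ v → 1 ≤ v → v ≤ n → ¬ (0 < ld A v × 0 < rd n A v))

IsReduced : ℕ → ℕ → Arcs → Set
IsReduced m n A =
  IsZigzagStack n A ×
  (∀ i → 1 ≤ i → i + (m ∸ 1) ≤ n → ld A i + rd n A (i + (m ∸ 1)) ≤ 2) ×
  (∀ i j → 1 ≤ i → i < j → j ≤ n → 0 < ld A i → 0 < rd n A j → i + (m ∸ 1) ≤ j)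

data Conn (A : Arcs) (x : ℕ) : ℕ → Set where
  here : Conn A x x
  fwd  : ∀ {y z} → Conn A x y → A y z ≡ true → Conn A x z
  bwd  : ∀ {y z} → Conn A x y → A z y ≡ true → Conn A x z

sub : Arcs → ℕ → ℕ → Arcs
sub A u ℓ i j = (1 ≤ᵇ i) ∧ (i <ᵇ j) ∧ (j ≤ᵇ ℓ) ∧ A (u + i) (u + j)

-- Boundary types.  The right boundary is  just b  for type (a , b) and
-- nothing  for type (a , *).
rightVal : Maybe ℕ → ℕ
rightVal (just b) = b
rightVal nothing = 0

-- top index of the extended vertex set {0, ..., top}
top : ℕ → Maybe ℕ → ℕ
top ℓ (just _) = suc ℓ
top ℓ nothing = ℓ

lam : ℕ → ℕ → Arcs → ℕ → ℕ
lam a ℓ T zero = a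
lam a ℓ T (suc k) = if suc k ≤ᵇ ℓ then ld T (suc k) else 0

rho : Maybe ℕ → ℕ → Arcs → ℕ → ℕ
rho b ℓ T zero = 0
rho b ℓ T (suc k) =
  if suc k ≤ᵇ ℓ then rd ℓ T (suc k)
  else (if suc k ≡ᵇ suc ℓ then rightVal b else 0)

IsOfType : ℕ → ℕ → Maybe ℕ → ℕ → Arcs → Set
IsOfType m a b ℓ T =
  IsReduced m ℓ T ×
  (∀ i → i + (m ∸ 1) ≤ top ℓ b → lam a ℓ T i + rho b ℓ T (i + (m ∸ 1)) ≤ 2) ×
  (∀ i j → i < j → j ≤ top ℓ b → 0 < lam a ℓ T i → 0 < rho b ℓ T j → i + (m ∸ 1) ≤ j)

BoundaryType : Set
BoundaryType = ℕ × Maybe ℕ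

OpenIntervalType : ℕ → Arcs → ℕ → ℕ → BoundaryType → Set
OpenIntervalType m A u w t = IsOfType m (proj₁ t) (proj₂ t) (w ∸ u ∸ 1) (sub A u (w ∸ u ∸ 1))

TailType : ℕ → ℕ → Arcs → ℕ → BoundaryType → Set
TailType m n A v t = IsOfType m (proj₁ t) (proj₂ t) (n ∸ v) (sub A v (n ∸ v))

ListedArc : ℕ → (ℕ → ℕ) → (ℕ → ℕ) → ℕ → ℕ → Set
ListedArc k u v i j =
  (∃[ s ] (1 ≤ s × s ≤ ⌊ k /2⌋ × i ≡ u s × j ≡ v s)) ⊎
  (∃[ s ] (1 ≤ s × s ≤ ⌈ k /2⌉ ∸ 1 × i ≡ u (suc s) × j ≡ v s))

PrimaryShape : Arcs → ℕ → (ℕ → ℕ) → (ℕ → ℕ) → Set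
PrimaryShape A k u v =
  u 1 ≡ 1 ×
  (∀ s → 1 ≤ s → s < ⌈ k /2⌉ → u s < u (suc s)) ×
  u ⌈ k /2⌉ < v ⌊ k /2⌋ ×
  (∀ s → 1 ≤ s → s < ⌊ k /2⌋ → v (suc s) < v s) ×
  (∀ w → Conn A 1 w ⇔
     ((∃[ s ] (1 ≤ s × s ≤ ⌈ k /2⌉ × w ≡ u s)) ⊎
      (∃[ s ] (1 ≤ s × s ≤ ⌊ k /2⌋ × w ≡ v s)))) ×
  (∀ i j → (A i j ≡ true × Conn A 1 i) ⇔ ListedArc k u v i j)

T1 T2 T2' T4 T4' T4* : BoundaryType
T1 = 0 , just 0
T2 = 1 , just 0
T2' = 0 , just 1
T4 = 2 , just 0
T4' = 0 , just 2
T4* = 2 , nothing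

-- The substructure on an interval ⟨p , w⟩ sees the boundary of S as the virtual
-- vertices 0 and ℓ + 1 with degrees a and b.  Every condition it has to satisfy is the
-- corresponding m-reducedness condition of S at the shifted vertices, because degrees
-- only drop when passing to a substructure, provided a ≤ ld(p) and b ≤ rd(w) in S.
-- Along the primary component these degrees are supplied by its arcs: each v_s
-- receives the arcs from u_s and u_{s+1}, each u_{s+1} sends arcs to v_s and v_{s+1}.
module Submission where

open import Defs
open import Data.Bool using (Bool; true; false; _∧_; if_then_else_)
open import Data.Bool.Properties using (T-≡)
open import Data.Nat using (ℕ; zero; suc; _+_; _*_; _∸_; _≤_; _<_; _≤ᵇ_; _<ᵇ_; _≡ᵇ_; z≤n; s≤s; ⌊_/2⌋; ⌈_/2⌉)
open import Data.Nat.Properties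
open import Data.Maybe using (Maybe; just; nothing)
open import Data.Product using (_×_; _,_; proj₁; proj₂)
open import Data.Sum using (inj₁; inj₂)
open import Function.Bundles using (Equivalence)
open import Relation.Binary.PropositionalEquality
open import Relation.Nullary using (¬_)

private
  variable
    m n ℓ a p w u i j s x y : ℕ
    b : Maybe ℕ
    A : Arcs

∧≡true⇒ : ∀ x {y} → x ∧ y ≡ true → x ≡ true × y ≡ true
∧≡true⇒ true e = refl , e

≡true⇒∧ : ∀ {x y} → x ≡ true → y ≡ true → x ∧ y ≡ true
≡true⇒∧ refl refl = refl

≤⇒≤ᵇ≡true : x ≤ y → (x ≤ᵇ y) ≡ true
≤⇒≤ᵇ≡true x≤y = Equivalence.to T-≡ (≤⇒≤ᵇ x≤y)

<⇒<ᵇ≡true : x < y → (x <ᵇ y) ≡ true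
<⇒<ᵇ≡true x<y = Equivalence.to T-≡ (<⇒<ᵇ x<y)

if-mono : ∀ {x y} → (x ≡ true → y ≡ true) → (if x then 1 else 0) ≤ (if y then 1 else 0)
if-mono {false} _ = z≤n
if-mono {true} x⇒y rewrite x⇒y refl = ≤-refl

count-mono : ∀ {f g} N → (∀ i → i < N → f i ≡ true → g i ≡ true) → count f N ≤ count g N
count-mono zero _ = z≤n
count-mono {f} (suc N) f⇒g =
  +-mono-≤ (count-mono N (λ i i<N → f⇒g i (m<n⇒m<1+n i<N))) (if-mono (f⇒g N ≤-refl))

count-monoʳ : ∀ f {N M} → N ≤ M → count f N ≤ count f M
count-monoʳ f {M = zero} z≤n = ≤-refl
count-monoʳ f {M = suc M} N≤1+M with m≤n⇒m<n∨m≡n N≤1+M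
... | inj₁ (s≤s N≤M) = ≤-trans (count-monoʳ f N≤M) (m≤m+n _ _)
... | inj₂ refl = ≤-refl

count-shift : ∀ g u N → count (λ i → g (u + i)) N ≤ count g (u + N)
count-shift g u zero = z≤n
count-shift g u (suc N) rewrite +-suc u N = +-monoˡ-≤ _ (count-shift g u N)

1≤count : ∀ f {N x} → x < N → f x ≡ true → 1 ≤ count f N
1≤count f {suc N} x<1+N fx with m<1+n⇒m<n∨m≡n x<1+N
... | inj₁ x<N = ≤-trans (1≤count f x<N fx) (m≤m+n _ _)
... | inj₂ refl rewrite fx = m≤n+m 1 _

2≤count : ∀ f {N x y} → x < y → y < N → f x ≡ true → f y ≡ true → 2 ≤ count f N
2≤count f {suc N} x<y y<1+N fx fy with m<1+n⇒m<n∨m≡n y<1+N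
... | inj₁ y<N = ≤-trans (2≤count f x<y y<N fx fy) (m≤m+n _ _)
... | inj₂ refl rewrite fy = +-monoˡ-≤ 1 (1≤count f x<y fx)

arc⇒1≤ld : A x w ≡ true → 1 ≤ x → x < w → 1 ≤ ld A w
arc⇒1≤ld e 1≤x x<w = 1≤count _ x<w (≡true⇒∧ (≤⇒≤ᵇ≡true 1≤x) e)

arcs⇒2≤ld : A x w ≡ true → A y w ≡ true → 1 ≤ x → x < y → y < w → 2 ≤ ld A w
arcs⇒2≤ld e₁ e₂ 1≤x x<y y<w =
  2≤count _ x<y y<w (≡true⇒∧ (≤⇒≤ᵇ≡true 1≤x) e₁)
                    (≡true⇒∧ (≤⇒≤ᵇ≡true (≤-trans 1≤x (<⇒≤ x<y))) e₂)

arc⇒1≤rd : A p y ≡ true → p < y → y ≤ n → 1 ≤ rd n A p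
arc⇒1≤rd e p<y y≤n = 1≤count _ (s≤s y≤n) (≡true⇒∧ (<⇒<ᵇ≡true p<y) e)

arcs⇒2≤rd : A p x ≡ true → A p y ≡ true → p < x → x < y → y ≤ n → 2 ≤ rd n A p
arcs⇒2≤rd e₁ e₂ p<x x<y y≤n =
  2≤count _ x<y (s≤s y≤n) (≡true⇒∧ (<⇒<ᵇ≡true p<x) e₁)
                          (≡true⇒∧ (<⇒<ᵇ≡true (<-trans p<x x<y)) e₂)

sub-arc : sub A u ℓ i j ≡ true → 1 ≤ i × i < j × j ≤ ℓ × A (u + i) (u + j) ≡ true
sub-arc {u = u} {ℓ} {i} {j} e
  with 1≤i , e₁ ← ∧≡true⇒ (1 ≤ᵇ i) e
  with i<j , e₂ ← ∧≡true⇒ (i <ᵇ j) e₁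
  with j≤ℓ , arc ← ∧≡true⇒ (j ≤ᵇ ℓ) e₂
  = ≤ᵇ⇒≤ 1 i (Equivalence.from T-≡ 1≤i) , <ᵇ⇒< i j (Equivalence.from T-≡ i<j) ,
    ≤ᵇ⇒≤ j ℓ (Equivalence.from T-≡ j≤ℓ) , arc

ld-sub≤ : ∀ A u ℓ p → ld (sub A u ℓ) p ≤ ld A (u + p)
ld-sub≤ A u ℓ p = ≤-trans (count-mono p lift) (count-shift (λ i → (1 ≤ᵇ i) ∧ A i (u + p)) u p)
  where
  lift : ∀ i → i < p → (1 ≤ᵇ i) ∧ sub A u ℓ i p ≡ true → (1 ≤ᵇ u + i) ∧ A (u + i) (u + p) ≡ true
  lift i _ e with 1≤i , _ , _ , arc ← sub-arc {A} {u} {ℓ} (proj₂ (∧≡true⇒ (1 ≤ᵇ i) e))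
    = ≡true⇒∧ (≤⇒≤ᵇ≡true (≤-trans 1≤i (m≤n+m i u))) arc

rd-sub≤ : ∀ A u ℓ → u + ℓ ≤ n → ∀ p → rd ℓ (sub A u ℓ) p ≤ rd n A (u + p)
rd-sub≤ {n} A u ℓ uℓ≤n p = begin
  rd ℓ (sub A u ℓ) p              ≤⟨ count-mono (suc ℓ) lift ⟩
  count (λ j → G (u + j)) (suc ℓ) ≤⟨ count-shift G u (suc ℓ) ⟩
  count G (u + suc ℓ)             ≤⟨ count-monoʳ G (≤-trans (≤-reflexive (+-suc u ℓ)) (s≤s uℓ≤n)) ⟩
  rd n A (u + p)                  ∎
  where
  open ≤-Reasoning
  G : ℕ → Bool
  G j = (u + p <ᵇ j) ∧ A (u + p) j
  lift : ∀ j → j < suc ℓ → (p <ᵇ j) ∧ sub A u ℓ p j ≡ true → G (u + j) ≡ true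
  lift j _ e with _ , p<j , _ , arc ← sub-arc {A} {u} {ℓ} (proj₂ (∧≡true⇒ (p <ᵇ j) e))
    = ≡true⇒∧ (<⇒<ᵇ≡true (+-monoʳ-< u p<j)) arc

-- l and r are the degree functions of a substructure at offset u: either its own ld and rd,
-- or the boundary-extended lam and rho.
module _ {m n : ℕ} {A : Arcs} (R : IsReduced m n A) {u : ℕ} (1≤u : 1 ≤ u) {l r : ℕ → ℕ}
         (l≤ld : ∀ i → l i ≤ ld A (u + i)) (r≤rd : ∀ i → r i ≤ rd n A (u + i)) where

  shifted-window : ∀ i → u + (i + (m ∸ 1)) ≤ n → l i + r (i + (m ∸ 1)) ≤ 2
  shifted-window i le = begin
    l i + r (i + (m ∸ 1))                     ≤⟨ +-mono-≤ (l≤ld i) (r≤rd (i + (m ∸ 1))) ⟩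
    ld A (u + i) + rd n A (u + (i + (m ∸ 1))) ≡⟨ cong (λ z → ld A (u + i) + rd n A z) u+[i+c]≡u+i+c ⟩
    ld A (u + i) + rd n A (u + i + (m ∸ 1))   ≤⟨ proj₁ (proj₂ R) (u + i) (≤-trans 1≤u (m≤m+n u i))
                                                   (subst (_≤ n) u+[i+c]≡u+i+c le) ⟩
    2                                         ∎
    where
    open ≤-Reasoning
    u+[i+c]≡u+i+c : u + (i + (m ∸ 1)) ≡ u + i + (m ∸ 1)
    u+[i+c]≡u+i+c = sym (+-assoc u i _)

  shifted-gap : ∀ i j → i < j → u + j ≤ n → 0 < l i → 0 < r j → i + (m ∸ 1) ≤ j
  shifted-gap i j i<j uj≤n 0<li 0<rj = +-cancelˡ-≤ u _ _ (subst (_≤ u + j) (+-assoc u i _)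
    (proj₂ (proj₂ R) (u + i) (u + j) (≤-trans 1≤u (m≤m+n u i)) (+-monoʳ-< u i<j) uj≤n
      (<-≤-trans 0<li (l≤ld i)) (<-≤-trans 0<rj (r≤rd j))))

sub-isReduced : IsReduced m n A → 1 ≤ u → u + ℓ ≤ n → IsReduced m ℓ (sub A u ℓ)
sub-isReduced {m} {n} {A} {u} {ℓ} R@((_ , stack , degree , zigzag) , _) 1≤u uℓ≤n =
  (diagram , stack′ , degree′ , zigzag′) , window , gap
  where
  ld≤ : ∀ p → ld (sub A u ℓ) p ≤ ld A (u + p)
  ld≤ = ld-sub≤ A u ℓ
  rd≤ : ∀ p → rd ℓ (sub A u ℓ) p ≤ rd n A (u + p)
  rd≤ = rd-sub≤ A u ℓ uℓ≤n
  1≤u+ : ∀ i → 1 ≤ u + i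
  1≤u+ i = ≤-trans 1≤u (m≤m+n u i)
  inside : ∀ {i} → i ≤ ℓ → u + i ≤ n
  inside i≤ℓ = ≤-trans (+-monoʳ-≤ u i≤ℓ) uℓ≤n
  diagram : IsDiagram ℓ (sub A u ℓ)
  diagram i j e with 1≤i , i<j , j≤ℓ , _ ← sub-arc {A} {u} {ℓ} e = 1≤i , i<j , j≤ℓ
  stack′ : IsStack (sub A u ℓ)
  stack′ i₁ j₁ i₂ j₂ e₁ e₂ (i₁<i₂ , i₂<j₁ , j₁<j₂) =
    stack _ _ _ _ (proj₂ (proj₂ (proj₂ (sub-arc {A} {u} {ℓ} e₁))))
                  (proj₂ (proj₂ (proj₂ (sub-arc {A} {u} {ℓ} e₂))))
                  (+-monoʳ-< u i₁<i₂ , +-monoʳ-< u i₂<j₁ , +-monoʳ-< u j₁<j₂)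
  degree′ : ∀ v → 1 ≤ v → v ≤ ℓ → deg ℓ (sub A u ℓ) v ≤ 2
  degree′ v _ v≤ℓ = ≤-trans (+-mono-≤ (ld≤ v) (rd≤ v)) (degree (u + v) (1≤u+ v) (inside v≤ℓ))
  zigzag′ : ∀ v → 1 ≤ v → v ≤ ℓ → ¬ (0 < ld (sub A u ℓ) v × 0 < rd ℓ (sub A u ℓ) v)
  zigzag′ v _ v≤ℓ (0<ld , 0<rd) =
    zigzag (u + v) (1≤u+ v) (inside v≤ℓ) (<-≤-trans 0<ld (ld≤ v) , <-≤-trans 0<rd (rd≤ v))
  window : ∀ i → 1 ≤ i → i + (m ∸ 1) ≤ ℓ → ld (sub A u ℓ) i + rd ℓ (sub A u ℓ) (i + (m ∸ 1)) ≤ 2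
  window i _ le = shifted-window {m} {n} {A} R 1≤u ld≤ rd≤ i (inside le)
  gap : ∀ i j → 1 ≤ i → i < j → j ≤ ℓ → 0 < ld (sub A u ℓ) i → 0 < rd ℓ (sub A u ℓ) j → i + (m ∸ 1) ≤ j
  gap i j _ i<j j≤ℓ = shifted-gap {m} {n} {A} R 1≤u ld≤ rd≤ i j i<j (inside j≤ℓ)

if-≤ : ∀ c {x y z} → x ≤ z → y ≤ z → (if c then x else y) ≤ z
if-≤ true x≤z _ = x≤z
if-≤ false _ y≤z = y≤z

lam-sub≤ : ∀ A u ℓ → a ≤ ld A u → ∀ p → lam a ℓ (sub A u ℓ) p ≤ ld A (u + p)
lam-sub≤ A u ℓ a≤ld zero rewrite +-identityʳ u = a≤ld
lam-sub≤ A u ℓ a≤ld (suc p) = if-≤ (suc p ≤ᵇ ℓ) (ld-sub≤ A u ℓ (suc p)) z≤n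

rho-sub≤ : ∀ A u ℓ b → u + ℓ ≤ n → rightVal b ≤ rd n A (u + suc ℓ) → ∀ p → rho b ℓ (sub A u ℓ) p ≤ rd n A (u + p)
rho-sub≤ A u ℓ b _ _ zero = z≤n
rho-sub≤ {n = n} A u ℓ b uℓ≤n b≤rd (suc p) = if-≤ (suc p ≤ᵇ ℓ) (rd-sub≤ A u ℓ uℓ≤n (suc p)) beyond
  where
  beyond : (if p ≡ᵇ ℓ then rightVal b else 0) ≤ rd n A (u + suc p)
  beyond with p ≡ᵇ ℓ in p≡ᵇℓ
  ... | true rewrite ≡ᵇ⇒≡ p ℓ (Equivalence.from T-≡ p≡ᵇℓ) = b≤rd
  ... | false = z≤n

ℓ≤top : ∀ ℓ b → ℓ ≤ top ℓ b
ℓ≤top ℓ (just _) = n≤1+n ℓ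
ℓ≤top ℓ nothing = ≤-refl

sub-isOfType : IsReduced m n A → 1 ≤ u → u + top ℓ b ≤ n →
  a ≤ ld A u → rightVal b ≤ rd n A (u + suc ℓ) → IsOfType m a b ℓ (sub A u ℓ)
sub-isOfType {m} {n} {A} {u} {ℓ} {b} {a} R 1≤u ut≤n a≤ld b≤rd =
  sub-isReduced {m} {n} {A} R 1≤u uℓ≤n , window , gap
  where
  uℓ≤n : u + ℓ ≤ n
  uℓ≤n = ≤-trans (+-monoʳ-≤ u (ℓ≤top ℓ b)) ut≤n
  lam≤ : ∀ p → lam a ℓ (sub A u ℓ) p ≤ ld A (u + p)
  lam≤ = lam-sub≤ A u ℓ a≤ld
  rho≤ : ∀ p → rho b ℓ (sub A u ℓ) p ≤ rd n A (u + p)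
  rho≤ = rho-sub≤ A u ℓ b uℓ≤n b≤rd
  window : ∀ i → i + (m ∸ 1) ≤ top ℓ b → lam a ℓ (sub A u ℓ) i + rho b ℓ (sub A u ℓ) (i + (m ∸ 1)) ≤ 2
  window i le = shifted-window {m} {n} {A} R 1≤u lam≤ rho≤ i (≤-trans (+-monoʳ-≤ u le) ut≤n)
  gap : ∀ i j → i < j → j ≤ top ℓ b → 0 < lam a ℓ (sub A u ℓ) i → 0 < rho b ℓ (sub A u ℓ) j → i + (m ∸ 1) ≤ j
  gap i j i<j j≤t = shifted-gap {m} {n} {A} R 1≤u lam≤ rho≤ i j i<j (≤-trans (+-monoʳ-≤ u j≤t) ut≤n)

m+suc[n∸m∸1]≡n : ∀ {m n} → m < n → m + suc (n ∸ m ∸ 1) ≡ n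
m+suc[n∸m∸1]≡n {zero} {suc n} _ = refl
m+suc[n∸m∸1]≡n {suc m} {suc n} (s≤s m<n) = cong suc (m+suc[n∸m∸1]≡n m<n)

openInterval-type : ∀ {b} → IsReduced m n A → 1 ≤ p → p < w → w ≤ n →
  a ≤ ld A p → b ≤ rd n A w → OpenIntervalType m A p w (a , just b)
openInterval-type {m} {n} {A} {p} {w} {a} {b} R 1≤p p<w w≤n a≤ld b≤rd =
  sub-isOfType {m} {n} {A} {p} {w ∸ p ∸ 1} {just b} R 1≤p
    (subst (_≤ n) (sym length≡) w≤n) a≤ld (subst (λ z → b ≤ rd n A z) (sym length≡) b≤rd)
  where
  length≡ : p + suc (w ∸ p ∸ 1) ≡ w
  length≡ = m+suc[n∸m∸1]≡n p<w

tail-type : IsReduced m n A → 1 ≤ p → p ≤ n → a ≤ ld A p → TailType m n A p (a , nothing)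
tail-type {m} {n} {A} {p} R 1≤p p≤n a≤ld =
  sub-isOfType {m} {n} {A} {p} {n ∸ p} {nothing} R 1≤p (≤-reflexive (m+[n∸m]≡n p≤n)) a≤ld z≤n

arc⇒openInterval-T1 : IsReduced m n A → A p w ≡ true → OpenIntervalType m A p w T1
arc⇒openInterval-T1 {m} {n} {A} R e with 1≤p , p<w , w≤n ← proj₁ (proj₁ R) _ _ e =
  openInterval-type {m} {n} {A} R 1≤p p<w w≤n z≤n z≤n

module PrimaryComponent {m n : ℕ} {A : Arcs} (R : IsReduced m n A) {k : ℕ} {u v : ℕ → ℕ} (P : PrimaryShape A k u v) where

  private
    endpoints : A i j ≡ true → 1 ≤ i × i < j × j ≤ n
    endpoints = proj₁ (proj₁ R) _ _

    listed⇒arc : ListedArc k u v i j → A i j ≡ true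
    listed⇒arc listed = proj₁ (Equivalence.from (proj₂ (proj₂ (proj₂ (proj₂ (proj₂ P)))) _ _) listed)

    u-increasing : 1 ≤ s → suc s ≤ ⌈ k /2⌉ → u s < u (suc s)
    u-increasing = proj₁ (proj₂ P) _

    v-decreasing : 1 ≤ s → suc s ≤ ⌊ k /2⌋ → v (suc s) < v s
    v-decreasing = proj₁ (proj₂ (proj₂ (proj₂ P))) _

  arc-u-v : 1 ≤ s → s ≤ ⌊ k /2⌋ → A (u s) (v s) ≡ true
  arc-u-v 1≤s s≤ = listed⇒arc (inj₁ (_ , 1≤s , s≤ , refl , refl))

  arc-u⁺-v : 1 ≤ s → suc s ≤ ⌈ k /2⌉ → A (u (suc s)) (v s) ≡ true
  arc-u⁺-v {s} 1≤s s<c = listed⇒arc (inj₂ (_ , 1≤s , s≤c∸1 , refl , refl))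
    where
    s≤c∸1 : s ≤ ⌈ k /2⌉ ∸ 1
    s≤c∸1 = subst (s ≤_) (pred[m∸n]≡m∸[1+n] ⌈ k /2⌉ 0) (suc[m]≤n⇒m≤pred[n] s<c)

  1≤ld-v : 1 ≤ s → s ≤ ⌊ k /2⌋ → 1 ≤ ld A (v s)
  1≤ld-v 1≤s s≤f with 1≤us , us<vs , _ ← endpoints (arc-u-v 1≤s s≤f) =
    arc⇒1≤ld {A = A} (arc-u-v 1≤s s≤f) 1≤us us<vs

  2≤ld-v : 1 ≤ s → s ≤ ⌊ k /2⌋ → suc s ≤ ⌈ k /2⌉ → 2 ≤ ld A (v s)
  2≤ld-v 1≤s s≤f s<c with 1≤us , _ ← endpoints (arc-u-v 1≤s s≤f)
                        | _ , us⁺<vs , _ ← endpoints (arc-u⁺-v 1≤s s<c) =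
    arcs⇒2≤ld {A = A} (arc-u-v 1≤s s≤f) (arc-u⁺-v 1≤s s<c) 1≤us (u-increasing 1≤s s<c) us⁺<vs

  1≤rd-u⁺ : 1 ≤ s → suc s ≤ ⌈ k /2⌉ → 1 ≤ rd n A (u (suc s))
  1≤rd-u⁺ 1≤s s<c with _ , us⁺<vs , vs≤n ← endpoints (arc-u⁺-v 1≤s s<c) =
    arc⇒1≤rd {A = A} (arc-u⁺-v 1≤s s<c) us⁺<vs vs≤n

  2≤rd-u⁺ : 1 ≤ s → suc s ≤ ⌊ k /2⌋ → suc s ≤ ⌈ k /2⌉ → 2 ≤ rd n A (u (suc s))
  2≤rd-u⁺ 1≤s s<f s<c with _ , us⁺<vs⁺ , _ ← endpoints (arc-u-v (s≤s z≤n) s<f)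
                         | _ , _ , vs≤n ← endpoints (arc-u⁺-v 1≤s s<c) =
    arcs⇒2≤rd {A = A} (arc-u-v (s≤s z≤n) s<f) (arc-u⁺-v 1≤s s<c) us⁺<vs⁺ (v-decreasing 1≤s s<f) vs≤n

  u-gap-type : ∀ {b} → 1 ≤ s → s ≤ ⌊ k /2⌋ → suc s ≤ ⌈ k /2⌉ → b ≤ rd n A (u (suc s)) →
    OpenIntervalType m A (u s) (u (suc s)) (0 , just b)
  u-gap-type 1≤s s≤f s<c b≤rd with 1≤us , _ ← endpoints (arc-u-v 1≤s s≤f)
                                | _ , us⁺<vs , vs≤n ← endpoints (arc-u⁺-v 1≤s s<c) =
    openInterval-type {m} {n} {A} R 1≤us (u-increasing 1≤s s<c) (≤-trans (<⇒≤ us⁺<vs) vs≤n) z≤n b≤rd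

  v-gap-type : 2 ≤ j → j ≤ ⌊ k /2⌋ → a ≤ ld A (v j) → OpenIntervalType m A (v j) (v (j ∸ 1)) (a , just 0)
  v-gap-type {suc s} (s≤s 1≤s) s<f a≤ld with 1≤us⁺ , us⁺<vs⁺ , _ ← endpoints (arc-u-v (s≤s z≤n) s<f)
                                          | _ , _ , vs≤n ← endpoints (arc-u-v 1≤s (≤-trans (n≤1+n s) s<f)) =
    openInterval-type {m} {n} {A} R (≤-trans 1≤us⁺ (<⇒≤ us⁺<vs⁺)) (v-decreasing 1≤s s<f) vs≤n a≤ld z≤n

  tail-type-T4* : 1 ≤ ⌊ k /2⌋ → 2 ≤ ⌈ k /2⌉ → TailType m n A (v 1) T4*
  tail-type-T4* 1≤f 2≤c with 1≤u₁ , u₁<v₁ , v₁≤n ← endpoints (arc-u-v ≤-refl 1≤f) =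
    tail-type {m} {n} {A} R (≤-trans 1≤u₁ (<⇒≤ u₁<v₁)) v₁≤n (2≤ld-v ≤-refl 1≤f 2≤c)

  even-case : ∀ h → ⌊ k /2⌋ ≡ h → ⌈ k /2⌉ ≡ h → 2 ≤ h →
    OpenIntervalType m A (u h) (v h) T1 ×
    OpenIntervalType m A (v h) (v (h ∸ 1)) T2 ×
    (∀ i → 1 ≤ i → i ≤ h ∸ 1 → OpenIntervalType m A (u i) (u (suc i)) T4') ×
    (∀ j → 2 ≤ j → j ≤ h ∸ 1 → OpenIntervalType m A (v j) (v (j ∸ 1)) T4) ×
    TailType m n A (v 1) T4*
  even-case h@(suc h′) f≡h c≡h (s≤s 1≤h′) =
    arc⇒openInterval-T1 {m} {n} {A} R (arc-u-v 1≤h (≤f ≤-refl)) ,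
    v-gap-type (s≤s 1≤h′) (≤f ≤-refl) (1≤ld-v 1≤h (≤f ≤-refl)) ,
    (λ i 1≤i i≤h′ → u-gap-type 1≤i (≤f (m≤n⇒m≤1+n i≤h′)) (≤c (s≤s i≤h′))
                      (2≤rd-u⁺ 1≤i (≤f (s≤s i≤h′)) (≤c (s≤s i≤h′)))) ,
    (λ j 2≤j j≤h′ → v-gap-type 2≤j (≤f (m≤n⇒m≤1+n j≤h′))
                      (2≤ld-v (≤-trans (n≤1+n 1) 2≤j) (≤f (m≤n⇒m≤1+n j≤h′)) (≤c (s≤s j≤h′)))) ,
    tail-type-T4* (≤f 1≤h) (≤c (s≤s 1≤h′))
    where
    1≤h : 1 ≤ h
    1≤h = s≤s z≤n
    ≤f : ∀ {x} → x ≤ h → x ≤ ⌊ k /2⌋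
    ≤f {x} = subst (x ≤_) (sym f≡h)
    ≤c : ∀ {x} → x ≤ h → x ≤ ⌈ k /2⌉
    ≤c {x} = subst (x ≤_) (sym c≡h)

  odd-case : ∀ h → ⌊ k /2⌋ ≡ h → ⌈ k /2⌉ ≡ suc h → 1 ≤ h →
    OpenIntervalType m A (u (suc h)) (v h) T1 ×
    OpenIntervalType m A (u h) (u (suc h)) T2' ×
    (∀ i → 1 ≤ i → i ≤ h ∸ 1 → OpenIntervalType m A (u i) (u (suc i)) T4') ×
    (∀ j → 2 ≤ j → j ≤ h → OpenIntervalType m A (v j) (v (j ∸ 1)) T4) ×
    TailType m n A (v 1) T4*
  odd-case h@(suc h′) f≡h c≡1+h 1≤h =
    arc⇒openInterval-T1 {m} {n} {A} R (arc-u⁺-v 1≤h (≤c ≤-refl)) ,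
    u-gap-type 1≤h (≤f ≤-refl) (≤c ≤-refl) (1≤rd-u⁺ 1≤h (≤c ≤-refl)) ,
    (λ i 1≤i i≤h′ → u-gap-type 1≤i (≤f (m≤n⇒m≤1+n i≤h′)) (≤c (s≤s (m≤n⇒m≤1+n i≤h′)))
                      (2≤rd-u⁺ 1≤i (≤f (s≤s i≤h′)) (≤c (s≤s (m≤n⇒m≤1+n i≤h′))))) ,
    (λ j 2≤j j≤h → v-gap-type 2≤j (≤f j≤h) (2≤ld-v (≤-trans (n≤1+n 1) 2≤j) (≤f j≤h) (≤c (s≤s j≤h)))) ,
    tail-type-T4* (≤f 1≤h) (≤c (s≤s 1≤h))
    where
    ≤f : ∀ {x} → x ≤ h → x ≤ ⌊ k /2⌋
    ≤f {x} = subst (x ≤_) (sym f≡h)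
    ≤c : ∀ {x} → x ≤ suc h → x ≤ ⌈ k /2⌉
    ≤c {x} = subst (x ≤_) (sym c≡1+h)

⌊2h/2⌋≡h : ∀ h → ⌊ 2 * h /2⌋ ≡ h
⌊2h/2⌋≡h h = sym (trans (n≡⌊n+n/2⌋ h) (cong (λ x → ⌊ h + x /2⌋) (sym (+-identityʳ h))))

⌈2h/2⌉≡h : ∀ h → ⌈ 2 * h /2⌉ ≡ h
⌈2h/2⌉≡h h = sym (trans (n≡⌈n+n/2⌉ h) (cong (λ x → ⌈ h + x /2⌉) (sym (+-identityʳ h))))

⌊2h+1/2⌋≡h : ∀ h → ⌊ 2 * h + 1 /2⌋ ≡ h
⌊2h+1/2⌋≡h h rewrite +-comm (2 * h) 1 = ⌈2h/2⌉≡h h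

⌈2h+1/2⌉≡1+h : ∀ h → ⌈ 2 * h + 1 /2⌉ ≡ suc h
⌈2h+1/2⌉≡1+h h rewrite +-comm (2 * h) 1 = cong suc (⌊2h/2⌋≡h h)

3≤2h⇒2≤h : ∀ {h} → 3 ≤ 2 * h → 2 ≤ h
3≤2h⇒2≤h {suc (suc _)} _ = s≤s (s≤s z≤n)
3≤2h⇒2≤h {suc zero} (s≤s (s≤s ()))

3≤2h+1⇒1≤h : ∀ {h} → 3 ≤ 2 * h + 1 → 1 ≤ h
3≤2h+1⇒1≤h {suc _} _ = s≤s z≤n
3≤2h+1⇒1≤h {zero} (s≤s ())

mainTheorem8 : (m n : ℕ) → 2 ≤ m → (A : Arcs) → IsReduced m n A → deg n A 1 ≡ 1 →
    (k : ℕ) → 3 ≤ k → (u v : ℕ → ℕ) → PrimaryShape A k u v →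
    ((h : ℕ) → k ≡ 2 * h →
      OpenIntervalType m A (u h) (v h) T1 ×
      OpenIntervalType m A (v h) (v (h ∸ 1)) T2 ×
      (∀ i → 1 ≤ i → i ≤ h ∸ 1 → OpenIntervalType m A (u i) (u (suc i)) T4') ×
      (∀ j → 2 ≤ j → j ≤ h ∸ 1 → OpenIntervalType m A (v j) (v (j ∸ 1)) T4) ×
      TailType m n A (v 1) T4*) ×
    ((h : ℕ) → k ≡ 2 * h + 1 →
      OpenIntervalType m A (u (suc h)) (v h) T1 ×
      OpenIntervalType m A (u h) (u (suc h)) T2' ×
      (∀ i → 1 ≤ i → i ≤ h ∸ 1 → OpenIntervalType m A (u i) (u (suc i)) T4') ×
      (∀ j → 2 ≤ j → j ≤ h → OpenIntervalType m A (v j) (v (j ∸ 1)) T4) ×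
      TailType m n A (v 1) T4*)
mainTheorem8 m n _ A R _ k 3≤k u v P =
  (λ h k≡2h → even-case h (trans (cong ⌊_/2⌋ k≡2h) (⌊2h/2⌋≡h h)) (trans (cong ⌈_/2⌉ k≡2h) (⌈2h/2⌉≡h h))
                          (3≤2h⇒2≤h (subst (3 ≤_) k≡2h 3≤k))) ,
  (λ h k≡2h+1 → odd-case h (trans (cong ⌊_/2⌋ k≡2h+1) (⌊2h+1/2⌋≡h h))
                            (trans (cong ⌈_/2⌉ k≡2h+1) (⌈2h+1/2⌉≡1+h h))
                            (3≤2h+1⇒1≤h (subst (3 ≤_) k≡2h+1 3≤k)))
  where open PrimaryComponent {m} {n} {A} R P
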